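{- Let $h=(C_1,\dots,C_n)$ be a concrete heap, let $\mathit{depth}$ be a given function on nodes, and let remove-node and remove-nodes be any procedures that always terminate and return a triple. Then the algorithm Heap-Abstract, run on $h$, always terminates (for every choice made during its execution).
   Context: A concrete heap is a finite sequence of disjoint labeled directed graphs (components) $C_i=(V_i,A_i,P_i)$, each with a layout attribute in $\{\mathit{SLL},\mathit{T},\mathit{C},\mathit{DAG}\}$, where $V_i$ is a finite set of variables, $A_i$ a finite set of memory addresses (nodes), $P_i\subseteq(V_i\times A_i)\cup(A_i\times A_i)$ for layouts $\mathit{SLL},\mathit{C},\mathit{DAG}$, and $P_i\subseteq(V_i\times A_i)\cup(A_i\times A_i\times\{l,r\})$ for layout $\mathit{T}$. Algorithm Heap-Abstract: for $i=1,\dots,n$, set $\hat{C}_i$ to Abstract-SLL$(C_i)$, Abstract-T$(C_i)$, Abstract-C$(C_i)$ or Abstract-DAG$(C_i)$ according as $C_i.\mathit{layout}$ is $\mathit{SLL}$, $\mathit{T}$, $\mathit{C}$ or $\mathit{DAG}$; return $(\hat{C}_1,\dots,\hat{C}_n)$. In what follows a component is written $(\hat{V},\hat{N},\hat{P})$. Abstract-SLL: a node $n$ is special if $(v,n)\in\hat{P}$ for some variable $v$, or $n\in\{a,b\}$ for some $(a,b)\in\hat{P}$ with $a,b\in\hat{N}$ and $\mathit{depth}(a)>\mathit{depth}(b)$; ordinary otherwise. $M\leftarrow$ ordinary nodes; while there are $a\neq b$ in $M$ with $(a,b)\in\hat{P}$: $(\hat{V},\hat{N},\hat{P})\leftarrow$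 remove-node$(b,\hat{V},\hat{N},\hat{P})$, $\hat{P}\leftarrow\hat{P}\cup\{(a,a)\}$, $M\leftarrow M\setminus\{b\}$; return the triple. Abstract-T (input of height $h_T$): a node $n$ is special if $(v,n)\in\hat{P}$ for some variable $v$, or $n\in\{a,b\}$ for some $(a,b,x)\in\hat{P}$ with $a\neq b$ and $\mathit{depth}(a)\ge\mathit{depth}(b)$; ordinary otherwise. $M\leftarrow$ ordinary nodes; for $i=h_T-1$ down to $1$: while $M$ has pairwise distinct $a,b,c$ with $\mathit{depth}(a)=i$, $(a,b,l),(a,c,r)\in\hat{P}$: $(\hat{V},\hat{N},\hat{P})\leftarrow$ remove-nodes$(b,c,\hat{V},\hat{N},\hat{P})$, $\hat{P}\leftarrow\hat{P}\cup\{(a,a,l),(a,a,r)\}$, $M\leftarrow M\setminus\{b,c\}$; return the triple. Abstract-C: for $n\in\hat{N}$ let $P_{in}(\{n\})=\{(x,n)\in\hat{P}\mid x\in\hat{N}\setminus\{n\}\}$, $P_{out}(\{n\})=\{(n,x)\in\hat{P}\mid x\in\hat{N}\setminus\{n\}\}$; $n$ is special if pointed to by a variable or $|P_{in}(\{n\})|>1$ or $|P_{out}(\{n\})|>1$, ordinary otherwise. $M\leftarrow$ ordinary nodes; while there are $a\neq b$ in $M$ with $(a,b)\in\hat{P}$: while some $(b,c)\in\hat{P}$ exists, replace it by $(a,c)$; $\hat{N}\leftarrow\hat{N}\setminus\{b\}$; $\hat{P}\leftarrow(\hat{P}\setminus\{(a,b)\})\cup\{(a,a)\}$; $M\leftarrow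 M\setminus\{b\}$; return the triple. Abstract-DAG: a node is special if pointed to by a variable, ordinary otherwise; distinct $a,b$ are reference similar if $(a,b),(b,a)\notin\hat{P}$ and $a,b$ have the same sets of node predecessors and of node successors; a set is reference similar if all its distinct pairs are. Ref-similar-DAG: $G\leftarrow\emptyset$, $M\leftarrow$ ordinary nodes; while $M\neq\emptyset$: pick $a\in M$, $A\leftarrow\{a\}$, for every $b\in M$ if $A\cup\{b\}$ is reference similar then $A\leftarrow A\cup\{b\}$; $G\leftarrow G\cup\{A\}$, $M\leftarrow M\setminus A$; return $G$. Abstract-DAG then takes every $A=\{a_1,\dots,a_n\}$ in Ref-similar-DAG's output with $|A|>1$, removes $a_2,\dots,a_n$ from $\hat{N}$ and all pointers having one of them as an endpoint from $\hat{P}$, adds $(a_1,a_1)$ to $\hat{P}$, and returns the resulting triple. -}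

module Defs where

open import Data.Nat using (ℕ; zero; suc; _<_; _≤_; _∸_; _⊔_) renaming (_≟_ to _≟ℕ_)
open import Data.List using (List; []; _∷_; _++_; [_]; filter; foldr)
open import Data.List.Membership.Propositional using (_∈_; _∉_)
open import Data.List.Membership.DecPropositional _≟ℕ_ using (_∈?_)
open import Data.List.Relation.Unary.All using (all?)
open import Data.List.Relation.Unary.AllPairs using (AllPairs)
open import Data.Maybe using (Maybe; just; nothing)
open import Data.Product using (Σ; _×_; _,_)
open import Data.Sum using (_⊎_)
open import Induction.WellFounded using (Acc)
open import Relation.Binary.PropositionalEquality using (_≡_; _≢_; refl)
open import Relation.Binary.Definitions using (DecidableEquality)
open import Relation.Nullary using (¬_; yes; no; ¬?)

Var : Set
Var = ℕ

Addr : Set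
Addr = ℕ

data Dir : Set where
  l r : Dir

data Ptr : Set where
  vp : Var → Addr → Ptr
  np : Addr → Addr → Ptr
  tp : Addr → Addr → Dir → Ptr

data Layout : Set where
  SLL T C DAG : Layout

-- a component / triple (V , N , P); finite sets represented as lists
record Triple : Set where
  constructor ⟨_,_,_⟩
  field
    V : List Var
    N : List Addr
    P : List Ptr
open Triple public

record Component : Set where
  constructor comp
  field
    layout : Layout
    graph  : Triple
open Component public

PtrOK : Layout → Triple → Ptr → Set
PtrOK L t (vp v a)   = v ∈ V t × a ∈ N t
PtrOK L t (np a b)   = L ≢ T × a ∈ N t × b ∈ N t
PtrOK L t (tp a b x) = L ≡ T × a ∈ N t × b ∈ N t

WFComponent : Component → Set
WFComponent c = ∀ p → p ∈ P (graph c) → PtrOK (layout c) (graph c) p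

Disjoint : Component → Component → Set
Disjoint c d = (∀ v → v ∈ V (graph c) → v ∉ V (graph d))
             × (∀ a → a ∈ N (graph c) → a ∉ N (graph d))

ConcreteHeap : List Component → Set
ConcreteHeap h = (∀ c → c ∈ h → WFComponent c) × AllPairs Disjoint h

_≟D_ : DecidableEquality Dir
l ≟D l = yes refl
l ≟D r = no λ ()
r ≟D l = no λ ()
r ≟D r = yes refl

_≟P_ : DecidableEquality Ptr
vp v a ≟P vp w b with v ≟ℕ w | a ≟ℕ b
... | yes refl | yes refl = yes refl
... | no ne | _ = no λ { refl → ne refl }
... | yes _ | no ne = no λ { refl → ne refl }
vp _ _ ≟P np _ _ = no λ ()
vp _ _ ≟P tp _ _ _ = no λ ()
np _ _ ≟P vp _ _ = no λ ()
np a b ≟P np c d with a ≟ℕ c | b ≟ℕ d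
... | yes refl | yes refl = yes refl
... | no ne | _ = no λ { refl → ne refl }
... | yes _ | no ne = no λ { refl → ne refl }
np _ _ ≟P tp _ _ _ = no λ ()
tp _ _ _ ≟P vp _ _ = no λ ()
tp _ _ _ ≟P np _ _ = no λ ()
tp a b x ≟P tp c d y with a ≟ℕ c | b ≟ℕ d | x ≟D y
... | yes refl | yes refl | yes refl = yes refl
... | no ne | _ | _ = no λ { refl → ne refl }
... | yes _ | no ne | _ = no λ { refl → ne refl }
... | yes _ | yes _ | no ne = no λ { refl → ne refl }

without : Addr → List Addr → List Addr
without b = filter (λ x → ¬? (x ≟ℕ b))

withoutAll : List Addr → List Addr → List Addr
withoutAll R = filter (λ x → ¬? (x ∈? R))

delPtr : Ptr → List Ptr → List Ptr
delPtr p = filter (λ q → ¬? (q ≟P p))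

ends : Ptr → List Addr
ends (vp v a)   = a ∷ []
ends (np a b)   = a ∷ b ∷ []
ends (tp a b x) = a ∷ b ∷ []

delPtrsAt : List Addr → List Ptr → List Ptr
delPtrsAt R = filter (λ p → all? (λ x → ¬? (x ∈? R)) (ends p))

addPtr : Ptr → Triple → Triple
addPtr p t = ⟨ V t , N t , p ∷ P t ⟩

OrdinaryNodes : (Triple → Addr → Set) → Triple → List Addr → Set
OrdinaryNodes Special t M =
  ∀ n → (n ∈ M → n ∈ N t × ¬ Special t n) × (n ∈ N t × ¬ Special t n → n ∈ M)

-- Algorithm Heap-Abstract, as a nondeterministic small-step semantics,
-- parameterised by depth, remove-node and remove-nodes.

module HeapAbstract
  (depth       : Addr → ℕ)
  (removeNode  : Addr → Triple → Triple)
  (removeNodes : Addr → Addr → Triple → Triple)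
  where

  PointedByVar : Triple → Addr → Set
  PointedByVar t n = Σ Var λ v → vp v n ∈ P t

  SpecialSLL : Triple → Addr → Set
  SpecialSLL t n = PointedByVar t n
    ⊎ Σ Addr λ a → Σ Addr λ b → np a b ∈ P t × a ∈ N t × b ∈ N t
        × depth b < depth a × (n ≡ a ⊎ n ≡ b)

  SpecialT : Triple → Addr → Set
  SpecialT t n = PointedByVar t n
    ⊎ Σ Addr λ a → Σ Addr λ b → Σ Dir λ x → tp a b x ∈ P t × a ≢ b
        × depth b ≤ depth a × (n ≡ a ⊎ n ≡ b)

  -- |P_in({n})| > 1 : two distinct nodes x ≠ n with (x , n) ∈ P
  InDegGt1 : Triple → Addr → Set
  InDegGt1 t n = Σ Addr λ x → Σ Addr λ y → x ≢ y
    × x ∈ N t × x ≢ n × np x n ∈ P t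
    × y ∈ N t × y ≢ n × np y n ∈ P t

  OutDegGt1 : Triple → Addr → Set
  OutDegGt1 t n = Σ Addr λ x → Σ Addr λ y → x ≢ y
    × x ∈ N t × x ≢ n × np n x ∈ P t
    × y ∈ N t × y ≢ n × np n y ∈ P t

  SpecialC : Triple → Addr → Set
  SpecialC t n = PointedByVar t n ⊎ InDegGt1 t n ⊎ OutDegGt1 t n

  SpecialDAG : Triple → Addr → Set
  SpecialDAG = PointedByVar

  height : Triple → ℕ
  height t = foldr (λ n m → depth n ⊔ m) 0 (N t)

  SameNodePreds : Triple → Addr → Addr → Set
  SameNodePreds t a b = ∀ x →
    ((x ∈ N t × np x a ∈ P t) → (x ∈ N t × np x b ∈ P t))
    × ((x ∈ N t × np x b ∈ P t) → (x ∈ N t × np x a ∈ P t))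

  SameNodeSuccs : Triple → Addr → Addr → Set
  SameNodeSuccs t a b = ∀ x →
    ((x ∈ N t × np a x ∈ P t) → (x ∈ N t × np b x ∈ P t))
    × ((x ∈ N t × np b x ∈ P t) → (x ∈ N t × np a x ∈ P t))

  RefSimilar : Triple → Addr → Addr → Set
  RefSimilar t a b = a ≢ b × np a b ∉ P t × np b a ∉ P t
    × SameNodePreds t a b × SameNodeSuccs t a b

  RefSimilarSet : Triple → List Addr → Set
  RefSimilarSet t A = ∀ a b → a ∈ A → b ∈ A → a ≢ b → RefSimilar t a b

  mergeDAG : Addr → List Addr → Triple → Triple
  mergeDAG a₁ A t =
    ⟨ V t , withoutAll (without a₁ A) (N t)
    , np a₁ a₁ ∷ delPtrsAt (without a₁ A) (P t) ⟩

  data SubState : Set where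
    sll      : Triple → List Addr → SubState
    tr       : Triple → List Addr → ℕ → SubState             -- (triple, M, current i; 0 = for loop done)
    cOuter   : Triple → List Addr → SubState
    cInner   : Triple → List Addr → Addr → Addr → SubState
    dagOuter : Triple → List (List Addr) → List Addr → SubState
    dagFor   : Triple → List (List Addr) → List Addr → List Addr → List Addr → SubState
    dagAbs   : Triple → List (List Addr) → SubState
    ret      : Triple → SubState

  data SubStep : SubState → SubState → Set where
    sll-step : ∀ {t M a b} → a ≢ b → a ∈ M → b ∈ M → np a b ∈ P t →
      SubStep (sll t M) (sll (addPtr (np a a) (removeNode b t)) (without b M))
    sll-exit : ∀ {t M} →
      ¬ (Σ Addr λ a → Σ Addr λ b → a ≢ b × a ∈ M × b ∈ M × np a b ∈ P t) →
      SubStep (sll t M) (ret t)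
    t-step : ∀ {t M i a b c} → a ≢ b → a ≢ c → b ≢ c → a ∈ M → b ∈ M → c ∈ M →
      depth a ≡ suc i → tp a b l ∈ P t → tp a c r ∈ P t →
      SubStep (tr t M (suc i))
              (tr (addPtr (tp a a r) (addPtr (tp a a l) (removeNodes b c t)))
                  (without c (without b M)) (suc i))
    t-next : ∀ {t M i} →
      ¬ (Σ Addr λ a → Σ Addr λ b → Σ Addr λ c → a ≢ b × a ≢ c × b ≢ c
           × a ∈ M × b ∈ M × c ∈ M × depth a ≡ suc i
           × tp a b l ∈ P t × tp a c r ∈ P t) →
      SubStep (tr t M (suc i)) (tr t M i)
    t-exit : ∀ {t M} → SubStep (tr t M zero) (ret t)
    c-start : ∀ {t M a b} → a ≢ b → a ∈ M → b ∈ M → np a b ∈ P t →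
      SubStep (cOuter t M) (cInner t M a b)
    c-redirect : ∀ {t M a b c} → np b c ∈ P t →
      SubStep (cInner t M a b)
              (cInner ⟨ V t , N t , np a c ∷ delPtr (np b c) (P t) ⟩ M a b)
    c-finish : ∀ {t M a b} → ¬ (Σ Addr λ c → np b c ∈ P t) →
      SubStep (cInner t M a b)
              (cOuter ⟨ V t , without b (N t) , np a a ∷ delPtr (np a b) (P t) ⟩
                      (without b M))
    c-exit : ∀ {t M} →
      ¬ (Σ Addr λ a → Σ Addr λ b → a ≢ b × a ∈ M × b ∈ M × np a b ∈ P t) →
      SubStep (cOuter t M) (ret t)
    dag-pick : ∀ {t G M a} → a ∈ M →
      SubStep (dagOuter t G M) (dagFor t G M [ a ] M)
    dag-add : ∀ {t G M A rest b} → b ∈ rest → RefSimilarSet t (b ∷ A) →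
      SubStep (dagFor t G M A rest) (dagFor t G M (b ∷ A) (without b rest))
    dag-skip : ∀ {t G M A rest b} → b ∈ rest → ¬ RefSimilarSet t (b ∷ A) →
      SubStep (dagFor t G M A rest) (dagFor t G M A (without b rest))
    dag-group : ∀ {t G M A} →
      SubStep (dagFor t G M A []) (dagOuter t (A ∷ G) (withoutAll A M))
    dag-grouped : ∀ {t G} → SubStep (dagOuter t G []) (dagAbs t G)
    dag-merge : ∀ {t G A a₁} → a₁ ∈ A →
      (Σ Addr λ x → Σ Addr λ y → x ∈ A × y ∈ A × x ≢ y) →
      SubStep (dagAbs t (A ∷ G)) (dagAbs (mergeDAG a₁ A t) G)
    dag-keep : ∀ {t G A} →
      ¬ (Σ Addr λ x → Σ Addr λ y → x ∈ A × y ∈ A × x ≢ y) →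
      SubStep (dagAbs t (A ∷ G)) (dagAbs t G)
    dag-exit : ∀ {t} → SubStep (dagAbs t []) (ret t)

  data Init : Component → SubState → Set where
    init-SLL : ∀ {t M} → OrdinaryNodes SpecialSLL t M → Init (comp SLL t) (sll t M)
    init-T   : ∀ {t M} → OrdinaryNodes SpecialT t M →
               Init (comp T t) (tr t M (height t ∸ 1))
    init-C   : ∀ {t M} → OrdinaryNodes SpecialC t M → Init (comp C t) (cOuter t M)
    init-DAG : ∀ {t M} → OrdinaryNodes SpecialDAG t M → Init (comp DAG t) (dagOuter t [] M)

  record HState : Set where
    constructor hs
    field
      done : List Triple
      cur  : Maybe SubState
      todo : List Component

  data Step : HState → HState → Set where
    h-start : ∀ {D c cs s} → Init c s →
      Step (hs D nothing (c ∷ cs)) (hs D (just s) cs)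
    h-sub : ∀ {D s s' cs} → SubStep s s' →
      Step (hs D (just s) cs) (hs D (just s') cs)
    h-ret : ∀ {D t cs} →
      Step (hs D (just (ret t)) cs) (hs (D ++ [ t ]) nothing cs)

  initial : List Component → HState
  initial h = hs [] nothing h

  -- termination for every sequence of choices: the initial state is
  -- accessible for the (converse) step relation, i.e. no infinite run
  Terminates : HState → Set
  Terminates = Acc (λ y x → Step x y)

-- Every loop of the four sub-algorithms strictly shrinks a finite quantity: the
-- list M of ordinary nodes (SLL, T, outer loops of C and DAG), the candidates
-- still to be tried in Ref-similar-DAG, the loop counter of T, the list G of
-- groups to merge, or, in the inner loop of Abstract-C, the number of pointers
-- leaving b — redirecting (b, c) to (a, c) removes one of them and adds none,
-- since a ≠ b. Heap-Abstract itself consumes one component per sub-run.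
module Submission where

open import Defs
open import Data.Nat using (ℕ; zero; suc; _+_; _<_; _≤_; z≤n; s≤s) renaming (_≟_ to _≟ℕ_)
open import Data.Nat.Properties using (≤-trans; <-≤-trans; ≤-<-trans; m≤n+m; +-monoʳ-≤; +-monoʳ-<)
open import Data.Nat.Induction using (<-wellFounded)
open import Data.List using (List; []; _∷_; length)
open import Data.List.Properties using (length-filter; filter-notAll)
open import Data.List.Relation.Unary.Any using (here; there)
import Data.List.Relation.Unary.Any as Any
open import Data.List.Membership.Propositional using (_∈_)
open import Data.Maybe using (just; nothing)
open import Data.Empty using (⊥-elim)
open import Function using (flip)
open import Induction.WellFounded using (Acc; acc; WfRec)
open import Relation.Binary.PropositionalEquality using (_≡_; _≢_; refl; subst; sym)
open import Relation.Nullary using (yes; no; ¬?)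

length-without-≤ : ∀ b M → length (without b M) ≤ length M
length-without-≤ b M = length-filter _ M

length-without-< : ∀ {b M} → b ∈ M → length (without b M) < length M
length-without-< {b} {M} b∈M =
  filter-notAll (λ x → ¬? (x ≟ℕ b)) M (Any.map (λ b≡x x≢b → x≢b (sym b≡x)) b∈M)

length-withoutAll-< : ∀ {x A M} → x ∈ A → x ∈ M → length (withoutAll A M) < length M
length-withoutAll-< {A = A} {M} x∈A x∈M =
  filter-notAll _ M (Any.map (λ x≡y y∉A → y∉A (subst (_∈ A) x≡y x∈A)) x∈M)

isEdgeFrom : Addr → Ptr → ℕ
isEdgeFrom b (np a _) with a ≟ℕ b
... | yes _ = 1
... | no  _ = 0
isEdgeFrom b _ = 0

edgesFrom : Addr → List Ptr → ℕ
edgesFrom b []       = 0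
edgesFrom b (p ∷ ps) = isEdgeFrom b p + edgesFrom b ps

isEdgeFrom-source : ∀ b c → isEdgeFrom b (np b c) ≡ 1
isEdgeFrom-source b c with b ≟ℕ b
... | yes _   = refl
... | no b≢b  = ⊥-elim (b≢b refl)

isEdgeFrom-other : ∀ {a b} c → a ≢ b → isEdgeFrom b (np a c) ≡ 0
isEdgeFrom-other {a} {b} c a≢b with a ≟ℕ b
... | yes a≡b = ⊥-elim (a≢b a≡b)
... | no  _   = refl

edgesFrom-delPtr-≤ : ∀ b p P → edgesFrom b (delPtr p P) ≤ edgesFrom b P
edgesFrom-delPtr-≤ b p []      = z≤n
edgesFrom-delPtr-≤ b p (q ∷ P) with q ≟P p
... | yes _ = ≤-trans (edgesFrom-delPtr-≤ b p P) (m≤n+m _ (isEdgeFrom b q))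
... | no  _ = +-monoʳ-≤ (isEdgeFrom b q) (edgesFrom-delPtr-≤ b p P)

edgesFrom-delPtr-< : ∀ {b c} P → np b c ∈ P → edgesFrom b (delPtr (np b c) P) < edgesFrom b P
edgesFrom-delPtr-< {b} {c} (_ ∷ P) (here refl) with np b c ≟P np b c
... | yes _ rewrite isEdgeFrom-source b c = s≤s (edgesFrom-delPtr-≤ b (np b c) P)
... | no p≢p = ⊥-elim (p≢p refl)
edgesFrom-delPtr-< {b} {c} (q ∷ P) (there p∈P) with q ≟P np b c
... | yes _ = <-≤-trans (edgesFrom-delPtr-< P p∈P) (m≤n+m _ (isEdgeFrom b q))
... | no  _ = +-monoʳ-< (isEdgeFrom b q) (edgesFrom-delPtr-< P p∈P)

edgesFrom-redirect-< : ∀ {a b c} P → a ≢ b → np b c ∈ P →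
  edgesFrom b (np a c ∷ delPtr (np b c) P) < edgesFrom b P
edgesFrom-redirect-< {a} {b} {c} P a≢b p∈P
  rewrite isEdgeFrom-other {a} {b} c a≢b = edgesFrom-delPtr-< P p∈P

module Termination (depth : Addr → ℕ)
                   (removeNode : Addr → Triple → Triple)
                   (removeNodes : Addr → Addr → Triple → Triple) where
  open HeapAbstract depth removeNode removeNodes

  SubTerminates : SubState → Set
  SubTerminates = Acc (flip SubStep)

  ret-terminates : ∀ t → SubTerminates (ret t)
  ret-terminates t = acc λ ()

  sll-terminates : ∀ t M → Acc _<_ (length M) → SubTerminates (sll t M)
  sll-terminates t M (acc smaller) = acc λ
    { (sll-step _ _ b∈M _) → sll-terminates _ _ (smaller (length-without-< b∈M))
    ; (sll-exit _)         → ret-terminates t }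

  tr-terminates : ∀ i t M → SubTerminates (tr t M i)
  tr-terminates zero    t M = acc λ { t-exit → ret-terminates t }
  tr-terminates (suc i) t M = level t M (<-wellFounded (length M))
    where
    level : ∀ t M → Acc _<_ (length M) → SubTerminates (tr t M (suc i))
    level t M (acc smaller) = acc λ
      { (t-step {b = b} {c} _ _ _ _ b∈M _ _ _ _) → level _ _ (smaller
          (≤-<-trans (length-without-≤ c (without b M)) (length-without-< b∈M)))
      ; (t-next _) → tr-terminates i t M }

  mutual
    cOuter-terminates : ∀ t M → Acc _<_ (length M) → SubTerminates (cOuter t M)
    cOuter-terminates t M (acc smaller) = acc λ
      { (c-start {b = b} a≢b _ b∈M _) →
          cInner-terminates t M a≢b (smaller (length-without-< b∈M))
            (<-wellFounded (edgesFrom b (P t)))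
      ; (c-exit _) → ret-terminates t }

    cInner-terminates : ∀ t M {a b} → a ≢ b → Acc _<_ (length (without b M)) →
      Acc _<_ (edgesFrom b (P t)) → SubTerminates (cInner t M a b)
    cInner-terminates t M a≢b accM (acc smaller) = acc λ
      { (c-redirect p∈P) →
          cInner-terminates _ M a≢b accM (smaller (edgesFrom-redirect-< (P t) a≢b p∈P))
      ; (c-finish _) → cOuter-terminates _ _ accM }

  dagAbs-terminates : ∀ t G → SubTerminates (dagAbs t G)
  dagAbs-terminates t []      = acc λ { dag-exit → ret-terminates t }
  dagAbs-terminates t (A ∷ G) = acc λ
    { (dag-merge _ _) → dagAbs-terminates _ G
    ; (dag-keep _)    → dagAbs-terminates t G }

  -- The group A under construction always contains the picked node x ∈ M,
  -- so closing the group shrinks M.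
  mutual
    dagOuter-terminates : ∀ t G M → Acc _<_ (length M) → SubTerminates (dagOuter t G M)
    dagOuter-terminates t G M (acc smaller) = acc λ
      { (dag-pick a∈M) →
          dagFor-terminates t G M (here refl) a∈M smaller (<-wellFounded (length M))
      ; dag-grouped → dagAbs-terminates t G }

    dagFor-terminates : ∀ t G M {A rest x} → x ∈ A → x ∈ M → WfRec _<_ (Acc _<_) (length M) →
      Acc _<_ (length rest) → SubTerminates (dagFor t G M A rest)
    dagFor-terminates t G M x∈A x∈M smallerM (acc smaller) = acc λ
      { (dag-add b∈rest _) →
          dagFor-terminates t G M (there x∈A) x∈M smallerM (smaller (length-without-< b∈rest))
      ; (dag-skip b∈rest _) →
          dagFor-terminates t G M x∈A x∈M smallerM (smaller (length-without-< b∈rest))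
      ; dag-group → dagOuter-terminates t _ _ (smallerM (length-withoutAll-< x∈A x∈M)) }

  init-terminates : ∀ {c s} → Init c s → SubTerminates s
  init-terminates (init-SLL {t} {M} _) = sll-terminates t M (<-wellFounded (length M))
  init-terminates (init-T {t} {M} _)   = tr-terminates _ t M
  init-terminates (init-C {t} {M} _)   = cOuter-terminates t M (<-wellFounded (length M))
  init-terminates (init-DAG {t} {M} _) = dagOuter-terminates t [] M (<-wellFounded (length M))

  running-terminates : ∀ {cs} → (∀ D → Terminates (hs D nothing cs)) →
    ∀ D {s} → SubTerminates s → Terminates (hs D (just s) cs)
  running-terminates idle D (acc next) = acc λ
    { (h-sub step) → running-terminates idle D (next step)
    ; h-ret        → idle _ }

  idle-terminates : ∀ cs D → Terminates (hs D nothing cs)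
  idle-terminates []       D = acc λ ()
  idle-terminates (c ∷ cs) D = acc λ
    { (h-start init) → running-terminates (idle-terminates cs) D (init-terminates init) }

theorem11 : (depth : Addr → ℕ)
            (removeNode : Addr → Triple → Triple)
            (removeNodes : Addr → Addr → Triple → Triple)
            (h : List Component) → ConcreteHeap h →
            HeapAbstract.Terminates depth removeNode removeNodes
              (HeapAbstract.initial depth removeNode removeNodes h)
theorem11 depth removeNode removeNodes h _ =
  Termination.idle-terminates depth removeNode removeNodes h []
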